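{- Let $G$ be a graph with $V(G)=\{v_1,\dots,v_n\}$, and let $H$ be the graph with vertex set $V(G)\cup\{v_1',\dots,v_n'\}$ and edge set $E(G)\cup\{v_iv_i' : i\in[n]\}\cup\{v_iv_j' : v_j\in N_G(v_i)\}\cup\{v_i'v_j' : v_j\in N_G(v_i)\}$. Then $\mathsf{IS}(H)=\mathsf{AM}(H)$.
   Context: All graphs are finite, simple and undirected; $N_G(v)$ is the set of neighbors of $v$ in $G$. For a matching $M$ in $H$, $V_M$ is the set of endpoints of its edges; $M$ is an acyclic matching if $H[V_M]$ is a forest. $\mathsf{AM}(H)$ is the maximum size (number of edges) of an acyclic matching in $H$, and $\mathsf{IS}(H)$ is the maximum size of an independent set in $H$. -}

module Defs where

open import Data.Nat using (ℕ; _+_; _≥_; _≤_)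
open import Data.Bool using (Bool; true; false; _∨_)

open import Data.Fin using (Fin; splitAt; _≟_)

open import Data.Fin.Subset using (Subset; _∈_; ∣_∣)
open import Data.Sum using (_⊎_; inj₁; inj₂)
open import Data.Product using (_×_; _,_; Σ; ∃)
open import Data.List using (List; []; _∷_; length; concatMap; _++_; [_])
open import Data.List.Relation.Unary.All using (All)
open import Data.List.Relation.Unary.Unique.Propositional using (Unique)
open import Data.List.Relation.Unary.Linked using (Linked)
open import Data.List.Membership.Propositional using () renaming (_∈_ to _∈ˡ_)
open import Relation.Nullary using (¬_; yes; no)
open import Relation.Nullary.Decidable using (⌊_⌋)
open import Relation.Binary.PropositionalEquality using (_≡_; refl)

record Graph (n : ℕ) : Set where
  field
    adj    : Fin n → Fin n → Bool
    sym    : ∀ u v → adj u v ≡ adj v u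
    irrefl : ∀ v → adj v v ≡ false

open Graph public

Adj : ∀ {n} → Graph n → Fin n → Fin n → Set
Adj G u v = adj G u v ≡ true

IsIndependentSet : ∀ {n} → Graph n → Subset n → Set
IsIndependentSet G S = ∀ u v → u ∈ S → v ∈ S → ¬ Adj G u v

IsMaxIndependentSetSize : ∀ {n} → Graph n → ℕ → Set
IsMaxIndependentSetSize G k =
  (Σ (Subset _) λ S → IsIndependentSet G S × ∣ S ∣ ≡ k)
  × (∀ S → IsIndependentSet G S → ∣ S ∣ ≤ k)

endpoints : ∀ {n} → List (Fin n × Fin n) → List (Fin n)
endpoints = concatMap (λ { (u , v) → u ∷ v ∷ [] })

IsMatching : ∀ {n} → Graph n → List (Fin n × Fin n) → Set
IsMatching G M = All (λ { (u , v) → Adj G u v }) M × Unique (endpoints M)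

IsCycle : ∀ {n} → Graph n → List (Fin n) → Set
IsCycle G [] = Data.Empty.⊥
  where import Data.Empty
IsCycle G (v₀ ∷ vs) =
  length vs ≥ 2 × Unique (v₀ ∷ vs) × Linked (Adj G) (v₀ ∷ vs ++ [ v₀ ])

InducedForest : ∀ {n} → Graph n → List (Fin n) → Set
InducedForest G X = ∀ cyc → IsCycle G cyc → ¬ All (_∈ˡ X) cyc

IsAcyclicMatching : ∀ {n} → Graph n → List (Fin n × Fin n) → Set
IsAcyclicMatching G M = IsMatching G M × InducedForest G (endpoints M)

IsMaxAcyclicMatchingSize : ∀ {n} → Graph n → ℕ → Set
IsMaxAcyclicMatchingSize G k =
  (Σ (List _) λ M → IsAcyclicMatching G M × length M ≡ k)
  × (∀ M → IsAcyclicMatching G M → length M ≤ k)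

-- The graph H built from G: vertex set Fin (n + n), where
-- v_i = i ↑ˡ n (first copy) and v_i' = n ↑ʳ i (second copy).

private
  hAdj : ∀ {n} → Graph n → Fin n ⊎ Fin n → Fin n ⊎ Fin n → Bool
  hAdj G (inj₁ i) (inj₁ j) = adj G i j
  hAdj G (inj₁ i) (inj₂ j) = ⌊ i ≟ j ⌋ ∨ adj G i j
  hAdj G (inj₂ i) (inj₁ j) = ⌊ j ≟ i ⌋ ∨ adj G j i
  hAdj G (inj₂ i) (inj₂ j) = adj G i j

  hSym : ∀ {n} (G : Graph n) x y → hAdj G x y ≡ hAdj G y x
  hSym G (inj₁ i) (inj₁ j) = Graph.sym G i j
  hSym G (inj₁ i) (inj₂ j) = refl
  hSym G (inj₂ i) (inj₁ j) = refl
  hSym G (inj₂ i) (inj₂ j) = Graph.sym G i j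

  hIrr : ∀ {n} (G : Graph n) x → hAdj G x x ≡ false
  hIrr G (inj₁ i) = irrefl G i
  hIrr G (inj₂ i) = irrefl G i

H : ∀ {n} → Graph n → Graph (n + n)
H {n} G = record
  { adj    = λ x y → hAdj G (splitAt n x) (splitAt n y)
  ; sym    = λ x y → hSym G (splitAt n x) (splitAt n y)
  ; irrefl = λ x → hIrr G (splitAt n x)
  }

module Submission where

-- In every graph F, AM ≤ IS: if M is an acyclic matching then F[V_M] is a forest, so some
-- vertex p of V_M has at most one neighbour in V_M, namely its partner r in M.  Deleting the
-- edge pr and recursing yields an independent set avoiding r, to which p can be added.
-- Conversely, an independent set S of H contains at most one of v_i, v_i', so it projects
-- to an independent set T of G with |T| = |S|; the rungs v_i v_i' (i ∈ T) form a matching in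
-- which every vertex is adjacent only to its twin, hence an acyclic one.

open import Defs hiding (sym)
open import Data.Bool using (true)
import Data.Bool.Properties as Bool
open import Data.Empty using () renaming (⊥-elim to contradiction⊥)
open import Data.Fin using (Fin; zero; suc; _↑ˡ_; _↑ʳ_; splitAt; join; _≟_)
open import Data.Fin.Properties using (all?; splitAt-↑ˡ; splitAt-↑ʳ; splitAt⁻¹-↑ˡ; splitAt⁻¹-↑ʳ)
import Data.Fin.Properties as Fin
open import Data.Fin.Subset using (Subset; _∈_; _∉_; ∣_∣; ⁅_⁆; _∪_; ⊥; outside; inside)
open import Data.Fin.Subset.Properties
  using (_∈?_; anySubset?; x∈⁅x⁆; x∈⁅y⁆⇒x≡y; x∈p∪q⁻; x∈p∪q⁺; q⊆p∪q; p⊂q⇒∣p∣<∣q∣; ∣p∣≤n; ∉⊥;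
         ∣⊥∣≡0)
open import Data.List using (List; []; _∷_; [_]; _++_; length; map; take)
open import Data.List.Properties using (length-++; length-map; ++-assoc)
open import Data.List.Membership.Propositional using (find) renaming (_∈_ to _∈ˡ_; _∉_ to _∉ˡ_)
open import Data.List.Membership.Propositional.Properties using (∈-∃++; ∈-concatMap⁻; ∈-map⁻)
import Data.List.Membership.DecPropositional as DecMembership
open import Data.List.Relation.Binary.Permutation.Propositional
  using (_↭_; refl; prep; swap; trans; ↭-refl; ↭-sym; ↭-trans; ↭⇒↭ₛ)
open import Data.List.Relation.Binary.Permutation.Propositional.Properties
  using (All-resp-↭; ∈-resp-↭; ↭-length; shift; shifts; ++⁺ˡ)
import Data.List.Relation.Binary.Permutation.Setoid.Properties as PermutationSetoid
open import Data.List.Relation.Binary.Subset.Propositional using () renaming (_⊆_ to _⊆ˡ_)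
open import Data.List.Relation.Binary.Subset.Propositional.Properties using (++⁺ʳ)
open import Data.List.Relation.Unary.All as All using (All; []; _∷_)
open import Data.List.Relation.Unary.All.Properties using (¬Any⇒All¬)
import Data.List.Relation.Unary.All.Properties as All
open import Data.List.Relation.Unary.AllPairs using ([]; _∷_)
open import Data.List.Relation.Unary.Any using (here; there; any?)
open import Data.List.Relation.Unary.Linked using (Linked; [-]; _∷_)
open import Data.List.Relation.Unary.Unique.Propositional using (Unique)
open import Data.List.Relation.Unary.Unique.Propositional.Properties using (Unique[x∷xs]⇒x∉xs)
import Data.List.Relation.Unary.Unique.Propositional.Properties as Unique
open import Data.Nat using (ℕ; zero; suc; _+_; _≤_; _<_; z≤n; s≤s)
import Data.Nat as ℕ
open import Data.Nat.Properties using (≤-trans; ≤-pred; ≤∧≢⇒<; <⇒≱; m≤n+m; m<m+n; +-suc; suc-injective)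
open import Data.Product using (_×_; _,_; Σ; ∃; ∃₂)
open import Data.Sum using (_⊎_; inj₁; inj₂; reduce) renaming (swap to swap⊎)
open import Data.Vec using (_∷_; [])
import Data.Vec.Base as Vec
open import Function using (_∘_)
open import Relation.Nullary using (¬_; Dec; yes; no; ¬?)
open import Relation.Nullary.Decidable using (_×-dec_; _→-dec_; decidable-stable)
open import Relation.Binary.PropositionalEquality using (_≡_; _≢_; refl; sym; cong; subst; setoid)
import Relation.Binary.PropositionalEquality as ≡

module _ {a} {A : Set a} where

  Unique-++⁻ˡ : ∀ xs {ys : List A} → Unique (xs ++ ys) → Unique xs
  Unique-++⁻ˡ []       _         = []
  Unique-++⁻ˡ (x ∷ xs) (x∉ ∷ u) = All.++⁻ˡ xs x∉ ∷ Unique-++⁻ˡ xs u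

  Unique-cut : ∀ xs {y : A} {zs} → Unique (xs ++ y ∷ zs) → Unique (xs ++ [ y ])
  Unique-cut xs {y} {zs} u = Unique-++⁻ˡ (xs ++ [ y ]) (subst Unique (sym (++-assoc xs [ y ] zs)) u)

  Linked-cut : ∀ {r} {R : A → A → Set r} xs {y z zs} →
               Linked R (xs ++ y ∷ zs) → R y z → Linked R ((xs ++ [ y ]) ++ [ z ])
  Linked-cut []            _         yz = yz ∷ [-]
  Linked-cut (x ∷ [])      (xy ∷ _)  yz = xy ∷ yz ∷ [-]
  Linked-cut (x ∷ x′ ∷ xs) (xx′ ∷ l) yz = xx′ ∷ Linked-cut (x′ ∷ xs) l yz

  take-1-unique : ∀ {y z} (xs : List A) → y ∈ˡ take 1 xs → z ∈ˡ take 1 xs → y ≡ z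
  take-1-unique (x ∷ _) (here refl) (here refl) = refl

  Unique-map⁺-injectiveOn : ∀ {b p} {B : Set b} {P : A → Set p} {f : A → B} →
                            (∀ {x y} → P x → P y → f x ≡ f y → x ≡ y) →
                            ∀ {xs} → All P xs → Unique xs → Unique (map f xs)
  Unique-map⁺-injectiveOn inj []         []        = []
  Unique-map⁺-injectiveOn inj (px ∷ pxs) (x∉ ∷ u) =
    All.map⁺ (All.zipWith (λ (x≢y , py) → x≢y ∘ inj px py) (x∉ , pxs)) ∷ Unique-map⁺-injectiveOn inj pxs u

  Unique-resp-↭ : ∀ {xs ys : List A} → xs ↭ ys → Unique xs → Unique ys
  Unique-resp-↭ xs↭ys = PermutationSetoid.Unique-resp-↭ (setoid A) (↭⇒↭ₛ xs↭ys)

module _ {N : ℕ} where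

  ∣⁅x⁆∪p∣ : ∀ {x} {p : Subset N} → x ∉ p → suc ∣ p ∣ ≤ ∣ ⁅ x ⁆ ∪ p ∣
  ∣⁅x⁆∪p∣ {x} {p} x∉p = p⊂q⇒∣p∣<∣q∣ (q⊆p∪q ⁅ x ⁆ p , x , x∈p∪q⁺ (inj₁ (x∈⁅x⁆ x)) , x∉p)

  fromList : List (Fin N) → Subset N
  fromList []       = ⊥
  fromList (x ∷ xs) = ⁅ x ⁆ ∪ fromList xs

  ∈-fromList⁻ : ∀ {x} xs → x ∈ fromList xs → x ∈ˡ xs
  ∈-fromList⁻ []       x∈ = contradiction⊥ (∉⊥ x∈)
  ∈-fromList⁻ (y ∷ xs) x∈ with x∈p∪q⁻ ⁅ y ⁆ (fromList xs) x∈
  ... | inj₁ x∈⁅y⁆ = here (x∈⁅y⁆⇒x≡y y x∈⁅y⁆)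
  ... | inj₂ x∈xs  = there (∈-fromList⁻ xs x∈xs)

  length≤∣fromList∣ : ∀ {xs} → Unique xs → length xs ≤ ∣ fromList xs ∣
  length≤∣fromList∣ []              = z≤n
  length≤∣fromList∣ {x ∷ xs} (x∉ ∷ u) =
    ≤-trans (s≤s (length≤∣fromList∣ {xs} u)) (∣⁅x⁆∪p∣ λ x∈ → All.lookup x∉ (∈-fromList⁻ xs x∈) refl)

  Unique⇒length≤ : ∀ {xs} → Unique xs → length xs ≤ N
  Unique⇒length≤ {xs} u = ≤-trans (length≤∣fromList∣ u) (∣p∣≤n (fromList xs))

toList : ∀ {N} → Subset N → List (Fin N)
toList []            = []
toList (outside ∷ S) = map suc (toList S)
toList (inside  ∷ S) = zero ∷ map suc (toList S)

Unique-toList : ∀ {N} (S : Subset N) → Unique (toList S)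
Unique-toList []            = []
Unique-toList (outside ∷ S) = Unique.map⁺ Fin.suc-injective (Unique-toList S)
Unique-toList (inside  ∷ S) =
  All.map⁺ (All.universal (λ _ ()) (toList S)) ∷ Unique.map⁺ Fin.suc-injective (Unique-toList S)

∈-toList⁻ : ∀ {N x} (S : Subset N) → x ∈ˡ toList S → x ∈ S

∈-map-suc⁻ : ∀ {N x b} (S : Subset N) → x ∈ˡ map suc (toList S) → x ∈ b ∷ S
∈-map-suc⁻ S x∈ with ∈-map⁻ suc x∈
... | y , y∈ , refl = Vec.there (∈-toList⁻ S y∈)

∈-toList⁻ (outside ∷ S) x∈ = ∈-map-suc⁻ S x∈
∈-toList⁻ (inside  ∷ S) (here refl) = Vec.here
∈-toList⁻ (inside  ∷ S) (there x∈) = ∈-map-suc⁻ S x∈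

length-toList : ∀ {N} (S : Subset N) → length (toList S) ≡ ∣ S ∣
length-toList []            = refl
length-toList (outside ∷ S) = ≡.trans (length-map suc (toList S)) (length-toList S)
length-toList (inside  ∷ S) = cong suc (≡.trans (length-map suc (toList S)) (length-toList S))

bounded-maximum : ∀ {p} {P : ℕ → Set p} → (∀ j → Dec (P j)) → P 0 → ∀ n → (∀ j → P j → j ≤ n) →
                  ∃ λ k → P k × (∀ j → P j → j ≤ k)
bounded-maximum P? P0 zero    bounded = 0 , P0 , bounded
bounded-maximum P? P0 (suc n) bounded with P? (suc n)
... | yes P1+n = suc n , P1+n , bounded
... | no ¬P1+n = bounded-maximum P? P0 n λ j Pj → ≤-pred (≤∧≢⇒< (bounded j Pj) λ { refl → ¬P1+n Pj })

module _ {m : ℕ} (F : Graph m) where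

  open DecMembership (Data.Fin._≟_ {m}) using () renaming (_∈?_ to _∈ˡ?_)

  Adj-sym : ∀ {u v} → Adj F u v → Adj F v u
  Adj-sym {u} {v} uv = ≡.trans (Graph.sym F v u) uv

  Adj-irrefl : ∀ {v} → ¬ Adj F v v
  Adj-irrefl {v} vv with () ← ≡.trans (sym (irrefl F v)) vv

  _∼?_ : ∀ u v → Dec (Adj F u v)
  u ∼? v = adj F u v Bool.≟ true

  AtMostOneNeighbourIn : List (Fin m) → Fin m → Set
  AtMostOneNeighbourIn X p = ∀ {y z} → y ∈ˡ X → z ∈ˡ X → Adj F p y → Adj F p z → y ≡ z

  degree≤1⇒InducedForest : ∀ {X} → (∀ {p} → p ∈ˡ X → AtMostOneNeighbourIn X p) → InducedForest F X
  degree≤1⇒InducedForest deg (_ ∷ [])         (() , _)                          _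
  degree≤1⇒InducedForest deg (_ ∷ _ ∷ [])     (s≤s () , _)                      _
  degree≤1⇒InducedForest deg (_ ∷ _ ∷ _ ∷ _) (_ , (c₀∉ ∷ _) , (c₀c₁ ∷ c₁c₂ ∷ _)) (c₀∈ ∷ c₁∈ ∷ c₂∈ ∷ _) =
    All.lookup c₀∉ (there (here refl)) (deg c₁∈ c₀∈ c₂∈ (Adj-sym c₀c₁) c₁c₂)

  chord⇒cycle : ∀ {p y ps} → Unique (p ∷ ps) → Linked (Adj F) (p ∷ ps) →
                y ∈ˡ ps → y ∉ˡ take 1 ps → Adj F y p → ∃ λ cyc → IsCycle F cyc × cyc ⊆ˡ p ∷ ps
  chord⇒cycle {p} {y} u path y∈ps y∉next yp with ∈-∃++ y∈ps
  ... | []     , zs , refl = contradiction⊥ (y∉next (here refl))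
  ... | w ∷ ws , zs , refl =
    p ∷ w ∷ ws ++ [ y ] ,
    (s≤s (subst (1 ≤_) (sym (length-++ ws)) (m≤n+m 1 (length ws))) ,
     Unique-cut (p ∷ w ∷ ws) u ,
     Linked-cut (p ∷ w ∷ ws) path yp) ,
    ++⁺ʳ (p ∷ w ∷ ws) λ { (here refl) → here refl }

  -- A simple path p ∷ ps in X, grown at p while p has a neighbour in X other than the next
  -- vertex on the path (take 1 ps).  Such a neighbour is never on the path, as that would close
  -- a cycle, so the path stays simple and the fuel bound (|path| ≤ m) is never exhausted.
  leaf-walk : ∀ {X} → InducedForest F X → (fuel : ℕ) (p : Fin m) (ps : List (Fin m)) →
              m < fuel + length (p ∷ ps) → Unique (p ∷ ps) → Linked (Adj F) (p ∷ ps) → p ∷ ps ⊆ˡ X →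
              ∃ λ q → q ∈ˡ X × AtMostOneNeighbourIn X q
  leaf-walk forest zero p ps bound u _ _ = contradiction⊥ (<⇒≱ bound (Unique⇒length≤ u))
  leaf-walk {X} forest (suc fuel) p ps bound u path ⊆X
    with any? (λ y → (p ∼? y) ×-dec ¬? (y ∈ˡ? take 1 ps)) X
  ... | no none = p , ⊆X (here refl) , λ y∈ z∈ py pz → take-1-unique ps (back y∈ py) (back z∈ pz)
    where
    back : ∀ {y} → y ∈ˡ X → Adj F p y → y ∈ˡ take 1 ps
    back y∈ py = decidable-stable (_ ∈ˡ? take 1 ps) λ y∉ → All.lookup (¬Any⇒All¬ X none) y∈ (py , y∉)
  ... | yes some with find some
  ... | y , y∈X , py , y∉next with y ∈ˡ? p ∷ ps
  ... | no y∉path =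
    leaf-walk forest fuel y (p ∷ ps) (subst (m <_) (sym (+-suc fuel _)) bound)
      (¬Any⇒All¬ _ y∉path ∷ u) (Adj-sym py ∷ path) λ { (here refl) → y∈X ; (there q∈) → ⊆X q∈ }
  ... | yes (here refl) = contradiction⊥ (Adj-irrefl py)
  ... | yes (there y∈ps) with chord⇒cycle u path y∈ps y∉next (Adj-sym py)
  ... | cyc , isCycle , cyc⊆path = contradiction⊥ (forest cyc isCycle (All.tabulate (⊆X ∘ cyc⊆path)))

  InducedForest⇒leaf : ∀ {X x} → InducedForest F X → x ∈ˡ X →
                       ∃ λ q → q ∈ˡ X × AtMostOneNeighbourIn X q
  InducedForest⇒leaf forest x∈ =
    leaf-walk forest m _ [] (m<m+n m (s≤s z≤n)) ([] ∷ []) [-] λ { (here refl) → x∈ }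

  InducedForest-⊆ : ∀ {X Y} → X ⊆ˡ Y → InducedForest F Y → InducedForest F X
  InducedForest-⊆ X⊆Y forest cyc isCycle cyc⊆X = forest cyc isCycle (All.map X⊆Y cyc⊆X)

  endpoints-↭ : ∀ {M N : List (Fin m × Fin m)} → M ↭ N → endpoints M ↭ endpoints N
  endpoints-↭ refl                       = ↭-refl
  endpoints-↭ (prep (u , v) M↭N)         = prep u (prep v (endpoints-↭ M↭N))
  endpoints-↭ (swap (u , v) (u′ , v′) M↭N) =
    ↭-trans (shifts (u ∷ v ∷ []) (u′ ∷ v′ ∷ [])) (++⁺ˡ (u′ ∷ v′ ∷ u ∷ v ∷ []) (endpoints-↭ M↭N))
  endpoints-↭ (trans M↭N N↭O)            = ↭-trans (endpoints-↭ M↭N) (endpoints-↭ N↭O)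

  IsAcyclicMatching-resp-↭ : ∀ {M N} → M ↭ N → IsAcyclicMatching F M → IsAcyclicMatching F N
  IsAcyclicMatching-resp-↭ M↭N ((edges , unique) , forest) =
    (All-resp-↭ M↭N edges , Unique-resp-↭ (endpoints-↭ M↭N) unique) ,
    InducedForest-⊆ (∈-resp-↭ (↭-sym (endpoints-↭ M↭N))) forest

  IsAcyclicMatching-tail : ∀ {e M} → IsAcyclicMatching F (e ∷ M) → IsAcyclicMatching F M
  IsAcyclicMatching-tail ((_ ∷ edges , _ ∷ _ ∷ unique) , forest) =
    (edges , unique) , InducedForest-⊆ (there ∘ there) forest

  matchedEdge : ∀ {M p} → IsAcyclicMatching F M → p ∈ˡ endpoints M →
                ∃₂ λ r M′ → Adj F p r × endpoints M ↭ p ∷ r ∷ endpoints M′ ×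
                            IsAcyclicMatching F M′ × length M ≡ suc (length M′)
  matchedEdge {M} acyclic p∈ with find (∈-concatMap⁻ _ {xs = M} p∈)
  ... | (u , v) , e∈M , p∈uv with ∈-∃++ e∈M
  ... | M₁ , M₂ , refl with IsAcyclicMatching-resp-↭ (shift (u , v) M₁ M₂) acyclic
  ... | acyclic′@((uv ∷ _ , _) , _) with p∈uv
  ... | here refl =
    v , M₁ ++ M₂ , uv , endpoints-↭ (shift _ M₁ M₂) ,
    IsAcyclicMatching-tail acyclic′ , ↭-length (shift _ M₁ M₂)
  ... | there (here refl) =
    u , M₁ ++ M₂ , Adj-sym uv , ↭-trans (endpoints-↭ (shift _ M₁ M₂)) (swap u v ↭-refl) ,
    IsAcyclicMatching-tail acyclic′ , ↭-length (shift _ M₁ M₂)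

  IsIndependentSet-⊥ : IsIndependentSet F ⊥
  IsIndependentSet-⊥ _ _ u∈ = contradiction⊥ (∉⊥ u∈)

  IsIndependentSet-⁅⁆∪ : ∀ {p S} → IsIndependentSet F S → (∀ {y} → y ∈ S → ¬ Adj F p y) →
                         IsIndependentSet F (⁅ p ⁆ ∪ S)
  IsIndependentSet-⁅⁆∪ {p} {S} indep p≁S u v u∈ v∈
    with x∈p∪q⁻ ⁅ p ⁆ S u∈ | x∈p∪q⁻ ⁅ p ⁆ S v∈
  ... | inj₁ u∈p | inj₁ v∈p
    rewrite x∈⁅y⁆⇒x≡y p u∈p | x∈⁅y⁆⇒x≡y p v∈p = Adj-irrefl
  ... | inj₁ u∈p | inj₂ v∈S rewrite x∈⁅y⁆⇒x≡y p u∈p = p≁S v∈S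
  ... | inj₂ u∈S | inj₁ v∈p rewrite x∈⁅y⁆⇒x≡y p v∈p = p≁S u∈S ∘ Adj-sym
  ... | inj₂ u∈S | inj₂ v∈S = indep u v u∈S v∈S

  -- With S inside V_M and independent, |M| ≤ |S| forces exactly one vertex per edge of M.
  IndependentTransversal : List (Fin m × Fin m) → Set
  IndependentTransversal M =
    ∃ λ S → IsIndependentSet F S × (∀ {x} → x ∈ S → x ∈ˡ endpoints M) × length M ≤ ∣ S ∣

  acyclicMatching⇒independentTransversal : ∀ k {M} → length M ≡ k → IsAcyclicMatching F M →
                                           IndependentTransversal M
  acyclicMatching⇒independentTransversal zero {[]} _ _ =
    ⊥ , IsIndependentSet-⊥ , (λ x∈ → contradiction⊥ (∉⊥ x∈)) , z≤n
  acyclicMatching⇒independentTransversal (suc k) {M@(_ ∷ _)} |M|≡ acyclic@((_ , unique) , forest)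
    with InducedForest⇒leaf forest (here refl)
  ... | p , p∈M , p-leaf with matchedEdge acyclic p∈M
  ... | r , M′ , pr , M↭ , acyclic′ , |M|≡1+|M′|
    with acyclicMatching⇒independentTransversal k (suc-injective (≡.trans (sym |M|≡1+|M′|) |M|≡)) acyclic′
  ... | S , indep , S⊆M′ , |M′|≤|S| = ⁅ p ⁆ ∪ S , IsIndependentSet-⁅⁆∪ indep p≁S , ⊆M , |M|≤
    where
    p∉M′ : p ∉ˡ endpoints M′
    p∉M′ = Unique[x∷xs]⇒x∉xs (Unique-resp-↭ M↭ unique) ∘ there
    r∉M′ : r ∉ˡ endpoints M′
    r∉M′ with _ ∷ unique′ ← Unique-resp-↭ M↭ unique = Unique[x∷xs]⇒x∉xs unique′
    toM : ∀ {x} → x ∈ˡ p ∷ r ∷ endpoints M′ → x ∈ˡ endpoints M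
    toM = ∈-resp-↭ (↭-sym M↭)
    M′⊆M : endpoints M′ ⊆ˡ endpoints M
    M′⊆M = toM ∘ there ∘ there
    p-neighbour≡r : ∀ {y} → y ∈ˡ endpoints M → Adj F p y → y ≡ r
    p-neighbour≡r y∈ py = p-leaf y∈ (toM (there (here refl))) py pr
    p≁S : ∀ {y} → y ∈ S → ¬ Adj F p y
    p≁S y∈S py with refl ← p-neighbour≡r (M′⊆M (S⊆M′ y∈S)) py = r∉M′ (S⊆M′ y∈S)
    ⊆M : ∀ {x} → x ∈ ⁅ p ⁆ ∪ S → x ∈ˡ endpoints M
    ⊆M x∈ with x∈p∪q⁻ ⁅ p ⁆ S x∈
    ... | inj₁ x∈p rewrite x∈⁅y⁆⇒x≡y p x∈p = p∈M
    ... | inj₂ x∈S = M′⊆M (S⊆M′ x∈S)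
    |M|≤ : length M ≤ ∣ ⁅ p ⁆ ∪ S ∣
    |M|≤ = subst (_≤ ∣ ⁅ p ⁆ ∪ S ∣) (sym |M|≡1+|M′|)
                 (≤-trans (s≤s |M′|≤|S|) (∣⁅x⁆∪p∣ (p∉M′ ∘ S⊆M′)))

  IsIndependentSet? : ∀ S → Dec (IsIndependentSet F S)
  IsIndependentSet? S = all? λ u → all? λ v → (u ∈? S) →-dec ((v ∈? S) →-dec ¬? (u ∼? v))

  maxIndependentSetSize : ∃ (IsMaxIndependentSetSize F)
  maxIndependentSetSize
    with bounded-maximum (λ j → anySubset? λ S → IsIndependentSet? S ×-dec (∣ S ∣ ℕ.≟ j))
                         (⊥ , IsIndependentSet-⊥ , ∣⊥∣≡0 m) m (λ { _ (S , _ , refl) → ∣p∣≤n S })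
  ... | k , witness , maximal = k , witness , λ S indep → maximal ∣ S ∣ (S , indep , refl)

module _ {n : ℕ} (G : Graph n) where

  -- v_i is i ↑ˡ n and v_i' is n ↑ʳ i: π forgets the copy, twin switches it.
  π : Fin (n + n) → Fin n
  π x = reduce (splitAt n x)

  twin : Fin (n + n) → Fin (n + n)
  twin x = join n n (swap⊎ (splitAt n x))

  π-↑ˡ : ∀ i → π (i ↑ˡ n) ≡ i
  π-↑ˡ i = cong reduce (splitAt-↑ˡ n i n)

  π-↑ʳ : ∀ i → π (n ↑ʳ i) ≡ i
  π-↑ʳ i = cong reduce (splitAt-↑ʳ n n i)

  Adj-twin : ∀ x → Adj (H G) x (twin x)
  Adj-twin x with splitAt n x
  ... | inj₁ i rewrite splitAt-↑ʳ n n i with i ≟ i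
  ...   | yes _   = refl
  ...   | no i≢i = contradiction⊥ (i≢i refl)
  Adj-twin x | inj₂ i rewrite splitAt-↑ˡ n i n with i ≟ i
  ...   | yes _   = refl
  ...   | no i≢i = contradiction⊥ (i≢i refl)

  Adj-H⇒twin⊎Adj-π : ∀ {x y} → Adj (H G) x y → y ≡ twin x ⊎ Adj G (π x) (π y)
  Adj-H⇒twin⊎Adj-π {x} {y} xy with splitAt n x | splitAt n y in y≡
  ... | inj₁ i | inj₁ j = inj₂ xy
  ... | inj₂ i | inj₂ j = inj₂ xy
  ... | inj₁ i | inj₂ j with i ≟ j
  ...   | yes refl = inj₁ (sym (splitAt⁻¹-↑ʳ y≡))
  ...   | no _     = inj₂ xy
  Adj-H⇒twin⊎Adj-π {x} {y} xy | inj₂ i | inj₁ j with j ≟ i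
  ...   | yes refl = inj₁ (sym (splitAt⁻¹-↑ˡ y≡))
  ...   | no _     = inj₂ (Adj-sym G xy)

  Adj-π⇒Adj-H : ∀ {x y} → Adj G (π x) (π y) → Adj (H G) x y
  Adj-π⇒Adj-H {x} {y} ij with splitAt n x | splitAt n y
  ... | inj₁ i | inj₁ j = ij
  ... | inj₂ i | inj₂ j = ij
  ... | inj₁ i | inj₂ j rewrite ij = Bool.∨-zeroʳ _
  ... | inj₂ i | inj₁ j rewrite Adj-sym G ij = Bool.∨-zeroʳ _

  π-fibre : ∀ {x y} → π x ≡ π y → y ≡ x ⊎ y ≡ twin x
  π-fibre {x} {y} πx≡πy with splitAt n x in x≡ | splitAt n y in y≡
  ... | inj₁ i | inj₁ j with refl ← πx≡πy = inj₁ (≡.trans (sym (splitAt⁻¹-↑ˡ y≡)) (splitAt⁻¹-↑ˡ x≡))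
  ... | inj₂ i | inj₂ j with refl ← πx≡πy = inj₁ (≡.trans (sym (splitAt⁻¹-↑ʳ y≡)) (splitAt⁻¹-↑ʳ x≡))
  ... | inj₁ i | inj₂ j with refl ← πx≡πy = inj₂ (sym (splitAt⁻¹-↑ʳ y≡))
  ... | inj₂ i | inj₁ j with refl ← πx≡πy = inj₂ (sym (splitAt⁻¹-↑ˡ y≡))

  rung : Fin n → Fin (n + n) × Fin (n + n)
  rung i = i ↑ˡ n , n ↑ʳ i

  Adj-rung : ∀ i → Adj (H G) (i ↑ˡ n) (n ↑ʳ i)
  Adj-rung i = subst (Adj (H G) (i ↑ˡ n)) (cong (join n n ∘ swap⊎) (splitAt-↑ˡ n i n)) (Adj-twin (i ↑ˡ n))

  π-∈-rungs : ∀ T {x} → x ∈ˡ endpoints (map rung T) → π x ∈ˡ T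
  π-∈-rungs (i ∷ T) (here refl)         = here (π-↑ˡ i)
  π-∈-rungs (i ∷ T) (there (here refl)) = here (π-↑ʳ i)
  π-∈-rungs (i ∷ T) (there (there x∈))  = there (π-∈-rungs T x∈)

  Unique-endpoints-rungs : ∀ {T} → Unique T → Unique (endpoints (map rung T))
  Unique-endpoints-rungs {[]}    []        = []
  Unique-endpoints-rungs {i ∷ T} (i∉ ∷ u) =
    (↑ˡ≢↑ʳ ∷ fresh (π-↑ˡ i)) ∷ fresh (π-↑ʳ i) ∷ Unique-endpoints-rungs u
    where
    ↑ˡ≢↑ʳ : i ↑ˡ n ≢ n ↑ʳ i
    ↑ˡ≢↑ʳ eq with () ← ≡.trans (sym (splitAt-↑ˡ n i n)) (≡.trans (cong (splitAt n) eq) (splitAt-↑ʳ n n i))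
    fresh : ∀ {x} → π x ≡ i → All (x ≢_) (endpoints (map rung T))
    fresh πx≡i = All.tabulate λ y∈ x≡y →
      All.lookup i∉ (π-∈-rungs T y∈) (≡.trans (sym πx≡i) (cong π x≡y))

  rungs-acyclic : ∀ {T} → Unique T → (∀ {i j} → i ∈ˡ T → j ∈ˡ T → ¬ Adj G i j) →
                  IsAcyclicMatching (H G) (map rung T)
  rungs-acyclic {T} unique T-indep =
    (All.map⁺ (All.universal Adj-rung T) , Unique-endpoints-rungs unique) ,
    degree≤1⇒InducedForest (H G) λ x∈ y∈ z∈ xy xz →
      ≡.trans (twin-neighbour x∈ y∈ xy) (sym (twin-neighbour x∈ z∈ xz))
    where
    twin-neighbour : ∀ {x y} → x ∈ˡ endpoints (map rung T) → y ∈ˡ endpoints (map rung T) →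
                     Adj (H G) x y → y ≡ twin x
    twin-neighbour x∈ y∈ xy with Adj-H⇒twin⊎Adj-π xy
    ... | inj₁ y≡twin = y≡twin
    ... | inj₂ πxy    = contradiction⊥ (T-indep (π-∈-rungs T x∈) (π-∈-rungs T y∈) πxy)

  independentSet⇒acyclicMatching : ∀ {S} → IsIndependentSet (H G) S →
                                    ∃ λ M → IsAcyclicMatching (H G) M × length M ≡ ∣ S ∣
  independentSet⇒acyclicMatching {S} indep =
    map rung T ,
    rungs-acyclic (Unique-map⁺-injectiveOn π-injective (All.tabulate (∈-toList⁻ S)) (Unique-toList S)) T-indep ,
    (begin
      length (map rung T)  ≡⟨ length-map rung T ⟩
      length T             ≡⟨ length-map π (toList S) ⟩
      length (toList S)    ≡⟨ length-toList S ⟩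
      ∣ S ∣                ∎)
    where
    open ≡.≡-Reasoning
    T : List (Fin n)
    T = map π (toList S)
    π-injective : ∀ {s t} → s ∈ S → t ∈ S → π s ≡ π t → s ≡ t
    π-injective {s} {t} s∈ t∈ πs≡πt with π-fibre πs≡πt
    ... | inj₁ t≡s    = sym t≡s
    ... | inj₂ t≡twin = contradiction⊥ (indep s t s∈ t∈ (subst (Adj (H G) s) (sym t≡twin) (Adj-twin s)))
    T-indep : ∀ {i j} → i ∈ˡ T → j ∈ˡ T → ¬ Adj G i j
    T-indep i∈ j∈ ij with ∈-map⁻ π i∈ | ∈-map⁻ π j∈
    ... | s , s∈ , refl | t , t∈ , refl = indep s t (∈-toList⁻ S s∈) (∈-toList⁻ S t∈) (Adj-π⇒Adj-H ij)

corollary5 : ∀ {n} (G : Graph n) →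
    Σ ℕ λ k → IsMaxIndependentSetSize (H G) k × IsMaxAcyclicMatchingSize (H G) k
corollary5 G with maxIndependentSetSize (H G)
... | k , (S , indep , ∣S∣≡k) , maximal =
  k , ((S , indep , ∣S∣≡k) , maximal) , (largeMatching , matchingBound)
  where
  largeMatching : ∃ λ M → IsAcyclicMatching (H G) M × length M ≡ k
  largeMatching with independentSet⇒acyclicMatching G indep
  ... | M , acyclic , |M|≡∣S∣ = M , acyclic , ≡.trans |M|≡∣S∣ ∣S∣≡k
  matchingBound : ∀ M → IsAcyclicMatching (H G) M → length M ≤ k
  matchingBound M acyclic with acyclicMatching⇒independentTransversal (H G) _ refl acyclic
  ... | S′ , indep′ , _ , |M|≤∣S′∣ = ≤-trans |M|≤∣S′∣ (maximal S′ indep′)
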